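{- Let $(T,\mathcal{C},\mathcal{I},A)$ be a storyline instance and consider the integer linear program (PLO) described in the context. For every optimal solution of (PLO), defining for each $i$ the linear order $\pi_i$ of $\operatorname{AC}(t_i)$ by $c_u\prec_{\pi_i}c_v$ if and only if $x_{i,u,v}=1$ yields a storyline solution $(\pi_1,\dots,\pi_\ell)$ whose number of crossings is minimum among all storyline solutions of the instance.
   Context: A storyline instance $(T,\mathcal{C},\mathcal{I},A)$ consists of totally ordered time steps $T=\{t_1,\dots,t_\ell\}$, a set of characters $\mathcal{C}=\{c_1,\dots,c_n\}$, a set of interactions $\mathcal{I}$, where each interaction $I$ has a time step $\operatorname{time}(I)\in T$ and a character set $\operatorname{char}(I)\subseteq\mathcal{C}$, and a map $A$ assigning to each character $c$ a set of consecutive time steps (those at which $c$ is active). Let $\operatorname{AC}(t)=\{c: t\in A(c)\}$, $\operatorname{AC}(t_i,t_{j})=\operatorname{AC}(t_i)\cap\dots\cap\operatorname{AC}(t_j)$, $\mathcal{I}(t)=\{I:\operatorname{time}(I)=t\}$, $\operatorname{CI}(t)=\bigcup_{I\in\mathcal{I}(t)}\operatorname{char}(I)$. It is assumed that $\operatorname{char}(I)\subseteq\operatorname{AC}(\operatorname{time}(I))$, that $\mathcal{I}(t)\ne\emptyset$ for every $t$, and that interactions at a common time step have pairwise disjoint character sets. A storyline solution is a sequence $(\pi_1,\dots,\pi_\ell)$, $\pi_i$ a linear order of $\operatorname{AC}(t_i)$ in which each $\operatorname{char}(I)$, $I\in\mathcal{I}(t_i)$, is consecutive; its number of crossings is the sum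 over $i=1,\dots,\ell-1$ of the number of pairs of characters in $\operatorname{AC}(t_i)\cap\operatorname{AC}(t_{i+1})$ whose relative order differs in $\pi_i$ and $\pi_{i+1}$. Below, characters named $c_u,c_v,c_w$ in the same constraint are pairwise distinct. (PLO) has binary variables $x_{i,u,v}$ for $i=1,\dots,\ell$ and $c_u,c_v\in\operatorname{AC}(t_i)$, and binary variables $y_{i,u,v}$ for $i=1,\dots,\ell-1$ and $c_u,c_v\in\operatorname{AC}(t_i,t_{i+1})$. It minimizes $\sum_{i=1}^{\ell-1}\sum_{c_u,c_v\in\operatorname{AC}(t_i,t_{i+1})}y_{i,u,v}$ (sum over ordered pairs) subject to: (EQ) $x_{i,u,v}=1-x_{i,v,u}$ for all $i$ and $c_u,c_v\in\operatorname{AC}(t_i)$; (TREE) $x_{i,u,w}=x_{i,v,w}$ for all $i$, $I\in\mathcal{I}(t_i)$, $c_u,c_v\in\operatorname{char}(I)$, $c_w\in\operatorname{AC}(t_i)\setminus\operatorname{char}(I)$; (CR) $y_{i,u,v}\ge x_{i,u,v}-x_{i+1,u,v}$ for all $i\le\ell-1$ and $c_u,c_v\in\operatorname{AC}(t_i,t_{i+1})$; and transitivity constraints (LOP) $x_{i,u,v}+x_{i,v,w}+x_{i,w,u}\le 2$, included as follows. Call $i\ge 2$ special if $\mathcal{I}(t_i)=\{I\}$ consists of a single interaction and $\operatorname{AC}(t_i)\setminus\operatorname{AC}(t_{i-1})\subseteq\operatorname{CI}(t_i)$. For non-special $i$ (including $i=1$), all (LOP) constraints for triples in $\operatorname{AC}(t_i)$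 are included. For special $i$ with its interaction $I$, fix a representative $c_w\in\operatorname{char}(I)$; among (LOP) constraints at $t_i$ whose triple contains at least one character outside $\operatorname{char}(I)$, only those whose triple consists of exactly two characters $c_u,c_v\in\operatorname{AC}(t_i)\setminus\operatorname{char}(I)$ together with $c_w$ are included, and for all $c_u,c_v\in\operatorname{AC}(t_i)\setminus\operatorname{char}(I)$ the constraints (PROP-R1) $x_{i,u,v}\ge x_{i-1,u,v}+x_{i,u,w}+x_{i,v,w}-2$ and (PROP-R2) $x_{i,u,v}\ge x_{i-1,u,v}+x_{i,w,u}+x_{i,w,v}-2$ are added. Moreover, for special $i$: if $\operatorname{char}(I)\subseteq\operatorname{AC}(t_{i-1})$, no (LOP) constraint with all three characters in $\operatorname{char}(I)$ is included and instead (PROP-I) $x_{i,u,v}=x_{i-1,u,v}$ is added for all $c_u,c_v\in\operatorname{char}(I)$; otherwise all (LOP) constraints with triples in $\operatorname{char}(I)$ are included. -}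

module Defs where

open import Data.Bool using (Bool; true; false; T; not; _∧_; _xor_)
open import Data.Nat using (ℕ; zero; suc; _+_; _∸_; _≤_; _<_)
open import Data.Fin using (Fin; toℕ; _≟_)
import Data.Fin as F
open import Data.Integer as ℤ using (ℤ)
open import Data.Empty using (⊥)
open import Data.Product using (Σ; ∃; ∃-syntax; _×_)
open import Relation.Binary.PropositionalEquality using (_≡_; _≢_)
open import Relation.Nullary using (¬_; does)

sumFin : ∀ {k} → (Fin k → ℕ) → ℕ
sumFin {zero}  f = 0
sumFin {suc k} f = f F.zero + sumFin (λ j → f (F.suc j))

sumBelow : ℕ → (ℕ → ℕ) → ℕ
sumBelow zero    f = 0
sumBelow (suc k) f = sumBelow k f + f k

count : Bool → ℕ
count true  = 1
count false = 0

⟦_⟧ : Bool → ℤ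
⟦ true ⟧  = ℤ.+ 1
⟦ false ⟧ = ℤ.+ 0

-- Storyline instances.
-- Time steps t_1..t_ℓ are encoded by the indices 0 .. ℓ-1 (index i is t_{i+1}).
-- Characters are Fin n, interactions are Fin m.

record Instance : Set where
  field
    ℓ n m  : ℕ
    active : Fin n → ℕ → Bool        -- active c i  <->  t_i ∈ A(c)
    time   : Fin m → ℕ
    member : Fin m → Fin n → Bool    -- member I c  <->  c ∈ char(I)

-- Binary variables of (PLO): x i u v and y i u v (true = 1, false = 0).
-- Only the values at indices where the paper has a variable matter.
record Assignment (n : ℕ) : Set where
  field
    x : ℕ → Fin n → Fin n → Bool
    y : ℕ → Fin n → Fin n → Bool

-- A candidate storyline solution: ord i u v = true  means  u ≺ v in π_i.
Orders : ℕ → Set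
Orders n = ℕ → Fin n → Fin n → Bool

module _ (S : Instance) where
  open Instance S

  AC : ℕ → Fin n → Set
  AC i c = T (active c i)

  Char : Fin m → Fin n → Set
  Char I c = T (member I c)

  Distinct3 : Fin n → Fin n → Fin n → Set
  Distinct3 u v w = u ≢ v × v ≢ w × u ≢ w

  record WellFormed : Set where
    field
      time<ℓ      : ∀ I → time I < ℓ
      consecutive : ∀ c t₁ t₂ t₃ → t₁ ≤ t₂ → t₂ ≤ t₃ → t₃ < ℓ →
                    AC t₁ c → AC t₃ c → AC t₂ c
      charActive  : ∀ I c → Char I c → AC (time I) c
      nonempty    : ∀ t → t < ℓ → ∃[ I ] time I ≡ t
      disjoint    : ∀ I J c → I ≢ J → time I ≡ time J → Char I c → Char J c → ⊥

  -- Special time steps (paper: i ≥ 2, i.e. index i ≥ 1 here)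

  SpecialWith : ℕ → Fin m → Set
  SpecialWith i I =
    1 ≤ i × i < ℓ × time I ≡ i × (∀ J → time J ≡ i → J ≡ I) ×
    (∀ c → AC i c → ¬ AC (i ∸ 1) c → Char I c)

  Special : ℕ → Set
  Special i = ∃[ I ] SpecialWith i I

  CharInPrev : ℕ → Fin m → Set
  CharInPrev i I = ∀ c → Char I c → AC (i ∸ 1) c

  -- The integer linear program (PLO), for a fixed choice of representatives
  -- rep i ∈ char(I) at special steps i.

  module _ (rep : ℕ → Fin n) (a : Assignment n) where
    open Assignment a

    X : ℕ → Fin n → Fin n → ℤ
    X i u v = ⟦ x i u v ⟧

    Y : ℕ → Fin n → Fin n → ℤ
    Y i u v = ⟦ y i u v ⟧

    LOP : ℕ → Fin n → Fin n → Fin n → Set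
    LOP i u v w = X i u v ℤ.+ X i v w ℤ.+ X i w u ℤ.≤ ℤ.+ 2

    record Feasible : Set where
      field
        eq   : ∀ i u v → i < ℓ → u ≢ v → AC i u → AC i v →
               X i u v ≡ ℤ.+ 1 ℤ.- X i v u
        tree : ∀ I u v w → u ≢ v → Char I u → Char I v →
               AC (time I) w → ¬ Char I w →
               X (time I) u w ≡ X (time I) v w
        cr   : ∀ i u v → suc i < ℓ → u ≢ v →
               AC i u → AC i v → AC (suc i) u → AC (suc i) v →
               Y i u v ℤ.≥ X i u v ℤ.- X (suc i) u v
        lopAll : ∀ i → i < ℓ → ¬ Special i → ∀ u v w → Distinct3 u v w →
                 AC i u → AC i v → AC i w → LOP i u v w
        lopRep : ∀ i I → SpecialWith i I → ∀ u v → u ≢ v →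
                 AC i u → AC i v → ¬ Char I u → ¬ Char I v →
                 LOP i u v (rep i)
        propR1 : ∀ i I → SpecialWith i I → ∀ u v → u ≢ v →
                 AC i u → AC i v → ¬ Char I u → ¬ Char I v →
                 X i u v ℤ.≥ X (i ∸ 1) u v ℤ.+ X i u (rep i) ℤ.+ X i v (rep i) ℤ.- ℤ.+ 2
        propR2 : ∀ i I → SpecialWith i I → ∀ u v → u ≢ v →
                 AC i u → AC i v → ¬ Char I u → ¬ Char I v →
                 X i u v ℤ.≥ X (i ∸ 1) u v ℤ.+ X i (rep i) u ℤ.+ X i (rep i) v ℤ.- ℤ.+ 2
        propI  : ∀ i I → SpecialWith i I → CharInPrev i I →
                 ∀ u v → u ≢ v → Char I u → Char I v → X i u v ≡ X (i ∸ 1) u v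
        lopIn  : ∀ i I → SpecialWith i I → ¬ CharInPrev i I →
                 ∀ u v w → Distinct3 u v w → Char I u → Char I v → Char I w →
                 LOP i u v w

  objective : Assignment n → ℕ
  objective a =
    sumBelow (ℓ ∸ 1) λ i → sumFin λ u → sumFin λ v →
      count (not (does (u ≟ v)) ∧ active u i ∧ active v i ∧
             active u (suc i) ∧ active v (suc i) ∧ Assignment.y a i u v)

  Optimal : (ℕ → Fin n) → Assignment n → Set
  Optimal rep a = Feasible rep a × (∀ b → Feasible rep b → objective a ≤ objective b)

  record IsStorylineSolution (ord : Orders n) : Set where
    field
      total   : ∀ i u v → i < ℓ → u ≢ v → AC i u → AC i v →
                ord i u v ≡ not (ord i v u)
      trans   : ∀ i u v w → i < ℓ → Distinct3 u v w → AC i u → AC i v → AC i w →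
                T (ord i u v) → T (ord i v w) → T (ord i u w)
      block   : ∀ I u v w → u ≢ v → Char I u → Char I v →
                AC (time I) w → ¬ Char I w →
                ¬ (T (ord (time I) u w) × T (ord (time I) w v))

  crossings : Orders n → ℕ
  crossings ord =
    sumBelow (ℓ ∸ 1) λ i → sumFin λ u → sumFin λ v →
      count (does (toℕ u Data.Nat.<? toℕ v) ∧ active u i ∧ active v i ∧
             active u (suc i) ∧ active v (suc i) ∧ (ord i u v xor ord (suc i) u v))

-- A feasible point of (PLO) is a storyline solution. At a special step with interaction I and
-- representative w, (TREE) and the triples through w force the order "before w, then char(I),
-- then after w", and inside each of these three blocks (PROP-R1), (PROP-R2), (PROP-I) copy the
-- order of the previous step (or (LOP) holds inside char(I)), so transitivity propagates along
-- the steps. By (CR) its objective bounds its crossings from above.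
-- Conversely, a storyline solution becomes feasible once every pair that the propagation
-- constraints want kept in place keeps its previous order. With y the actual changes, this point
-- costs exactly its crossings, and these are at most those of the original solution: at every
-- step the pairs on which the two solutions disagree pay for the extra crossings.

{-# OPTIONS --safe #-}
module Submission where

open import Defs
open import Data.Bool using (Bool; true; false; T; not; _∧_; _xor_; if_then_else_)
import Data.Bool as Bool
open import Data.Bool.Properties using (xor-same; ∧-zeroʳ)
open import Data.Nat using (ℕ; zero; suc; _+_; _∸_; _≤_; _<_; z≤n; s≤s; _<?_; _≤?_)
import Data.Nat as ℕ
open import Data.Nat.Properties
  using (≤-refl; ≤-trans; ≤-antisym; ≮⇒≥; +-mono-≤; +-identityʳ; +-assoc; <-cmp; <-irrefl;
         +-0-commutativeMonoid; ≤-<-trans; <-trans; n<1+n; n≤1+n; ≤-reflexive; m≤m+n; m∸n≤m;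
         <⇒≢; <ᵇ⇒<; module ≤-Reasoning)
open import Data.Fin using (Fin; toℕ; _≟_)
import Data.Fin as Fin
open import Data.Fin.Properties using (toℕ-injective; any?; all?)
open import Data.Integer as ℤ using (ℤ)
import Data.Integer.Properties as ℤ
open import Data.Empty using (⊥; ⊥-elim)
open import Data.Product using (_×_; _,_; proj₁; proj₂; ∃; ∃-syntax)
open import Data.Sum using (_⊎_; inj₁; inj₂)
open import Data.Unit using (tt)
open import Function using (_∘_; id)
open import Relation.Binary using (tri<; tri≈; tri>)
open import Relation.Binary.PropositionalEquality
open import Relation.Nullary using (¬_; Dec; does; yes; no; ¬?)
open import Relation.Nullary.Decidable
  using (True; toWitness; dec-true; dec-false; _×-dec_; _⊎-dec_; _→-dec_; T?)
open import Algebra.Properties.CommutativeMonoid.Sum +-0-commutativeMonoid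
  using (sum; ∑-distrib-+; ∑-comm)

complement-T : ∀ {a b} → a ≡ not b → ¬ T b → T a
complement-T {b = false} refl _  = tt
complement-T {b = true}  refl ¬b = ⊥-elim (¬b tt)

complement-¬T : ∀ {a b} → a ≡ not b → T b → ¬ T a
complement-¬T {b = true} refl _ ()

complement-≡false : ∀ {a b} → a ≡ not b → T b → a ≡ false
complement-≡false {b = true} refl _ = refl

≡true⇒T : ∀ {a} → a ≡ true → T a
≡true⇒T refl = tt

T⇒≡true : ∀ {a} → T a → a ≡ true
T⇒≡true {true} _ = refl

T-ext : ∀ {a b} → (T a → T b) → (T b → T a) → a ≡ b
T-ext {true}  {true}  _ _ = refl
T-ext {false} {false} _ _ = refl
T-ext {true}  {false} a⇒b _ = ⊥-elim (a⇒b tt)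
T-ext {false} {true}  _ b⇒a = ⊥-elim (b⇒a tt)

T-does⇒ : ∀ {A : Set} (a? : Dec A) → T (does a?) → A
T-does⇒ (yes a) _ = a

≢-from-not-does : ∀ {k} {u v : Fin k} → T (not (does (u ≟ v))) → u ≢ v
≢-from-not-does {u = u} {v} u≠v u≡v = subst (T ∘ not) (dec-true (u ≟ v) u≡v) u≠v

≤-by-computation : ∀ {p q : ℤ} {_ : True (p ℤ.≤? q)} → p ℤ.≤ q
≤-by-computation {_} {_} {p≤q} = toWitness p≤q

⟦⟧-injective : ∀ {a b} → ⟦ a ⟧ ≡ ⟦ b ⟧ → a ≡ b
⟦⟧-injective {true}  {true}  _ = refl
⟦⟧-injective {false} {false} _ = refl

⟦⟧-complement : ∀ {a b} → ⟦ a ⟧ ≡ ℤ.+ 1 ℤ.- ⟦ b ⟧ → a ≡ not b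
⟦⟧-complement {true}  {false} _ = refl
⟦⟧-complement {false} {true}  _ = refl

complement-⟦⟧ : ∀ a b → a ≡ not b → ⟦ a ⟧ ≡ ℤ.+ 1 ℤ.- ⟦ b ⟧
complement-⟦⟧ _ true  refl = refl
complement-⟦⟧ _ false refl = refl

lop⇒not-all : ∀ {a b c} → ⟦ a ⟧ ℤ.+ ⟦ b ⟧ ℤ.+ ⟦ c ⟧ ℤ.≤ ℤ.+ 2 → T a → T b → T c → ⊥
lop⇒not-all {true} {true} {true} (ℤ.+≤+ (s≤s (s≤s ()))) _ _ _

not-all⇒lop : ∀ a b c → (T a → T b → T c → ⊥) → ⟦ a ⟧ ℤ.+ ⟦ b ⟧ ℤ.+ ⟦ c ⟧ ℤ.≤ ℤ.+ 2
not-all⇒lop true  true  true  h = ⊥-elim (h tt tt tt)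
not-all⇒lop true  true  false _ = ≤-by-computation
not-all⇒lop true  false true  _ = ≤-by-computation
not-all⇒lop true  false false _ = ≤-by-computation
not-all⇒lop false true  true  _ = ≤-by-computation
not-all⇒lop false true  false _ = ≤-by-computation
not-all⇒lop false false true  _ = ≤-by-computation
not-all⇒lop false false false _ = ≤-by-computation

prop⇒implication : ∀ {a p b c} → ⟦ a ⟧ ℤ.≥ ⟦ p ⟧ ℤ.+ ⟦ b ⟧ ℤ.+ ⟦ c ⟧ ℤ.- ℤ.+ 2 →
                   T p → T b → T c → T a
prop⇒implication {true}                        _         _ _ _ = tt
prop⇒implication {false} {true} {true} {true} (ℤ.+≤+ ()) _ _ _

⟦⟧-mono : ∀ {a b} → (T a → T b) → ⟦ a ⟧ ℤ.≤ ⟦ b ⟧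
⟦⟧-mono {false} {false} _ = ≤-by-computation
⟦⟧-mono {false} {true}  _ = ≤-by-computation
⟦⟧-mono {true}  {true}  _ = ≤-by-computation
⟦⟧-mono {true}  {false} h = ⊥-elim (h tt)

-- the usual linearisation of a conjunction of 0/1 variables
⟦∧⟧-lower-bound : ∀ a b c → ⟦ a ⟧ ℤ.+ ⟦ b ⟧ ℤ.+ ⟦ c ⟧ ℤ.- ℤ.+ 2 ℤ.≤ ⟦ a ∧ b ∧ c ⟧
⟦∧⟧-lower-bound true  true  true  = ≤-by-computation
⟦∧⟧-lower-bound true  true  false = ≤-by-computation
⟦∧⟧-lower-bound true  false true  = ≤-by-computation
⟦∧⟧-lower-bound true  false false = ≤-by-computation
⟦∧⟧-lower-bound false true  true  = ≤-by-computation
⟦∧⟧-lower-bound false true  false = ≤-by-computation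
⟦∧⟧-lower-bound false false true  = ≤-by-computation
⟦∧⟧-lower-bound false false false = ≤-by-computation

implication⇒prop : ∀ a p b c → (T p → T b → T c → T a) →
                   ⟦ a ⟧ ℤ.≥ ⟦ p ⟧ ℤ.+ ⟦ b ⟧ ℤ.+ ⟦ c ⟧ ℤ.- ℤ.+ 2
implication⇒prop a p b c h = ℤ.≤-trans (⟦∧⟧-lower-bound p b c) (⟦⟧-mono (conj h))
  where
  conj : ∀ {p b c} → (T p → T b → T c → T a) → T (p ∧ b ∧ c) → T a
  conj {true} {true} {true} h _ = h tt tt tt

cr⇒implication : ∀ {y a b} → ⟦ y ⟧ ℤ.≥ ⟦ a ⟧ ℤ.- ⟦ b ⟧ → T (a ∧ not b) → T y
cr⇒implication {true}                     _         _ = tt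
cr⇒implication {false} {true} {false} (ℤ.+≤+ ()) _

cr-tight : ∀ a b → ⟦ a ∧ not b ⟧ ℤ.≥ ⟦ a ⟧ ℤ.- ⟦ b ⟧
cr-tight true  true  = ≤-by-computation
cr-tight true  false = ≤-by-computation
cr-tight false true  = ≤-by-computation
cr-tight false false = ≤-by-computation

count-mono : ∀ {a b} → (T a → T b) → count a ≤ count b
count-mono {false}         _ = z≤n
count-mono {true}  {true}  _ = ≤-refl
count-mono {true}  {false} h = ⊥-elim (h tt)

guarded-count-mono : ∀ g₁ g₂ g₃ g₄ g₅ {a b} → (T g₁ → T g₂ → T g₃ → T g₄ → T g₅ → T a → T b) →
  count (g₁ ∧ g₂ ∧ g₃ ∧ g₄ ∧ g₅ ∧ a) ≤ count (g₁ ∧ g₂ ∧ g₃ ∧ g₄ ∧ g₅ ∧ b)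
guarded-count-mono true  true  true  true  true  a⇒b = count-mono (a⇒b tt tt tt tt tt)
guarded-count-mono false _     _     _     _     _   = z≤n
guarded-count-mono true  false _     _     _     _   = z≤n
guarded-count-mono true  true  false _     _     _   = z≤n
guarded-count-mono true  true  true  false _     _   = z≤n
guarded-count-mono true  true  true  true  false _   = z≤n

count-xor-triangle : ∀ a b c → count (a xor c) ≤ count (a xor b) + count (b xor c)
count-xor-triangle true  true  true  = z≤n
count-xor-triangle true  true  false = s≤s z≤n
count-xor-triangle true  false true  = z≤n
count-xor-triangle true  false false = s≤s z≤n
count-xor-triangle false true  true  = s≤s z≤n
count-xor-triangle false true  false = z≤n
count-xor-triangle false false true  = s≤s z≤n
count-xor-triangle false false false = z≤n

-- the crossing of a pair {u, v} is seen exactly once among the two ordered pairs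
count-changes-both-ways :
  ∀ au av au′ av′ a b c d → (T au → T av → c ≡ not a) → (T au′ → T av′ → d ≡ not b) →
  count (au ∧ av ∧ au′ ∧ av′ ∧ (a ∧ not b)) + count (av ∧ au ∧ av′ ∧ au′ ∧ (c ∧ not d))
    ≡ count (au ∧ av ∧ au′ ∧ av′ ∧ (a xor b))
count-changes-both-ways true true true true a b c d c≡¬a d≡¬b
  rewrite c≡¬a tt tt | d≡¬b tt tt = both-ways a b
  where
  both-ways : ∀ a b → count (a ∧ not b) + count (not a ∧ not (not b)) ≡ count (a xor b)
  both-ways true  true  = refl
  both-ways true  false = refl
  both-ways false true  = refl
  both-ways false false = refl
count-changes-both-ways false false _     _     _ _ _ _ _ _ = refl
count-changes-both-ways false true  _     _     _ _ _ _ _ _ = refl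
count-changes-both-ways true  false _     _     _ _ _ _ _ _ = refl
count-changes-both-ways true  true  false false _ _ _ _ _ _ = refl
count-changes-both-ways true  true  false true  _ _ _ _ _ _ = refl
count-changes-both-ways true  true  true  false _ _ _ _ _ _ = refl

-- For one pair: b′ is its normalised order at step k, b and c its orders at steps k and k + 1,
-- and h says whether it is held at step k + 1; what remains is the triangle inequality for xor.
hold-step : ∀ lt au av au′ av′ b′ b c h → (T h → T au × T av) →
  let c′ = if h then b′ else c in
  count (lt ∧ au ∧ av ∧ au′ ∧ av′ ∧ (b′ xor c′)) + count (lt ∧ au′ ∧ av′ ∧ (c′ xor c))
    ≤ count (lt ∧ au ∧ av ∧ (b′ xor b)) + count (lt ∧ au ∧ av ∧ au′ ∧ av′ ∧ (b xor c))
hold-step false _     _     _     _     _  _ _ _     _ = z≤n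
hold-step true  false _     _     _     _  _ _ true  h = ⊥-elim (proj₁ (h tt))
hold-step true  true  false _     _     _  _ _ true  h = ⊥-elim (proj₂ (h tt))
hold-step true  false _     au′   av′   _  _ c false _
  rewrite xor-same c | ∧-zeroʳ av′ | ∧-zeroʳ au′ = z≤n
hold-step true  true  false au′   av′   _  _ c false _
  rewrite xor-same c | ∧-zeroʳ av′ | ∧-zeroʳ au′ = z≤n
hold-step true  true  true  false _     _  _ _ _     _ = z≤n
hold-step true  true  true  true  false _  _ _ _     _ = z≤n
hold-step true  true  true  true  true  b′ b c false _
  rewrite xor-same c | +-identityʳ (count (b′ xor c)) = count-xor-triangle b′ b c
hold-step true  true  true  true  true  b′ b c true  _
  rewrite xor-same b′ = count-xor-triangle b′ b c

sumFin-cong : ∀ {k} {f g : Fin k → ℕ} → (∀ j → f j ≡ g j) → sumFin f ≡ sumFin g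
sumFin-cong {zero}  _   = refl
sumFin-cong {suc k} f≗g = cong₂ _+_ (f≗g Fin.zero) (sumFin-cong (f≗g ∘ Fin.suc))

sumFin-mono : ∀ {k} {f g : Fin k → ℕ} → (∀ j → f j ≤ g j) → sumFin f ≤ sumFin g
sumFin-mono {zero}  _   = z≤n
sumFin-mono {suc k} f≤g = +-mono-≤ (f≤g Fin.zero) (sumFin-mono (f≤g ∘ Fin.suc))

sumFin≡sum : ∀ {k} (f : Fin k → ℕ) → sumFin f ≡ sum f
sumFin≡sum {zero}  f = refl
sumFin≡sum {suc k} f = cong (f Fin.zero +_) (sumFin≡sum (f ∘ Fin.suc))

sumFin-+ : ∀ {k} (f g : Fin k → ℕ) → sumFin (λ j → f j + g j) ≡ sumFin f + sumFin g
sumFin-+ f g = begin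
  sumFin (λ j → f j + g j)  ≡⟨ sumFin≡sum (λ j → f j + g j) ⟩
  sum (λ j → f j + g j)     ≡⟨ ∑-distrib-+ f g ⟩
  sum f + sum g             ≡⟨ sym (cong₂ _+_ (sumFin≡sum f) (sumFin≡sum g)) ⟩
  sumFin f + sumFin g       ∎
  where open ≡-Reasoning

sumPairs : ∀ {k} → (Fin k → Fin k → ℕ) → ℕ
sumPairs f = sumFin λ u → sumFin λ v → f u v

sumFin-zero : ∀ {k} → sumFin {k} (λ _ → 0) ≡ 0
sumFin-zero {zero}  = refl
sumFin-zero {suc k} = sumFin-zero {k}

sumPairs-zero : ∀ {k} → sumPairs {k} (λ _ _ → 0) ≡ 0
sumPairs-zero {k} = trans (sumFin-cong {k} (λ _ → sumFin-zero {k})) (sumFin-zero {k})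

sumPairs≡sum : ∀ {k} (f : Fin k → Fin k → ℕ) → sumPairs f ≡ sum (λ u → sum (f u))
sumPairs≡sum f = trans (sumFin-cong (sumFin≡sum ∘ f)) (sumFin≡sum (λ u → sum (f u)))

sumPairs-cong : ∀ {k} {f g : Fin k → Fin k → ℕ} → (∀ u v → f u v ≡ g u v) → sumPairs f ≡ sumPairs g
sumPairs-cong f≗g = sumFin-cong (sumFin-cong ∘ f≗g)

sumPairs-mono : ∀ {k} {f g : Fin k → Fin k → ℕ} → (∀ u v → f u v ≤ g u v) → sumPairs f ≤ sumPairs g
sumPairs-mono f≤g = sumFin-mono (sumFin-mono ∘ f≤g)

sumPairs-+ : ∀ {k} (f g : Fin k → Fin k → ℕ) →
             sumPairs (λ u v → f u v + g u v) ≡ sumPairs f + sumPairs g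
sumPairs-+ f g = trans (sumFin-cong (λ u → sumFin-+ (f u) (g u)))
                       (sumFin-+ (λ u → sumFin (f u)) (λ u → sumFin (g u)))

sumPairs-swap : ∀ {k} (f : Fin k → Fin k → ℕ) → sumPairs f ≡ sumPairs (λ u v → f v u)
sumPairs-swap f = begin
  sumPairs f                      ≡⟨ sumPairs≡sum f ⟩
  sum (λ u → sum (f u))           ≡⟨ ∑-comm f ⟩
  sum (λ v → sum (λ u → f u v))   ≡⟨ sym (sumPairs≡sum (λ v u → f u v)) ⟩
  sumPairs (λ u v → f v u)        ∎
  where open ≡-Reasoning

_before_ : ∀ {k} → Fin k → Fin k → Bool
u before v = does (toℕ u <? toℕ v)

sumPairs-unordered : ∀ {k} (f : Fin k → Fin k → ℕ) → (∀ u → f u u ≡ 0) →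
  sumPairs f ≡ sumPairs (λ u v → if u before v then f u v + f v u else 0)
sumPairs-unordered {k} f diagonal = begin
  sumPairs f
    ≡⟨ sumPairs-cong split ⟩
  sumPairs (λ u v → below f u v + below f′ v u)
    ≡⟨ sumPairs-+ (below f) (λ u v → below f′ v u) ⟩
  sumPairs (below f) + sumPairs (λ u v → below f′ v u)
    ≡⟨ cong (sumPairs (below f) +_) (sym (sumPairs-swap (below f′))) ⟩
  sumPairs (below f) + sumPairs (below f′)
    ≡⟨ sym (sumPairs-+ (below f) (below f′)) ⟩
  sumPairs (λ u v → below f u v + below f′ u v)
    ≡⟨ sumPairs-cong (λ u v → if-+ {f u v} {f v u} (u before v)) ⟩
  sumPairs (λ u v → if u before v then f u v + f v u else 0)
    ∎
  where
  open ≡-Reasoning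
  below : (Fin k → Fin k → ℕ) → Fin k → Fin k → ℕ
  below g u v = if u before v then g u v else 0
  f′ : Fin k → Fin k → ℕ
  f′ u v = f v u
  if-+ : ∀ {x y} b → (if b then x else 0) + (if b then y else 0) ≡ (if b then x + y else 0)
  if-+ true  = refl
  if-+ false = refl
  split : ∀ u v → f u v ≡ below f u v + below f′ v u
  split u v with <-cmp (toℕ u) (toℕ v)
  ... | tri< u<v _ v≮u rewrite dec-true (toℕ u <? toℕ v) u<v | dec-false (toℕ v <? toℕ u) v≮u =
        sym (+-identityʳ (f u v))
  ... | tri> u≮v _ v<u rewrite dec-false (toℕ u <? toℕ v) u≮v | dec-true (toℕ v <? toℕ u) v<u = refl
  ... | tri≈ _ u≡v _ with toℕ-injective u≡v
  ...   | refl rewrite dec-false (toℕ u <? toℕ u) (<-irrefl refl) = diagonal u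

<∸1⇒suc< : ∀ {i l} → i < l ∸ 1 → suc i < l
<∸1⇒suc< {l = suc l} i<l = s≤s i<l

sumBelow-mono : ∀ k {f g : ℕ → ℕ} → (∀ i → i < k → f i ≤ g i) → sumBelow k f ≤ sumBelow k g
sumBelow-mono zero    _   = z≤n
sumBelow-mono (suc k) f≤g =
  +-mono-≤ (sumBelow-mono k (λ i i<k → f≤g i (≤-trans i<k (n≤1+n k)))) (f≤g k ≤-refl)

sumBelow-cong : ∀ k {f g : ℕ → ℕ} → (∀ i → i < k → f i ≡ g i) → sumBelow k f ≡ sumBelow k g
sumBelow-cong zero    _   = refl
sumBelow-cong (suc k) f≗g =
  cong₂ _+_ (sumBelow-cong k (λ i i<k → f≗g i (≤-trans i<k (n≤1+n k)))) (f≗g k ≤-refl)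

sumBelow-potential : ∀ {f g D : ℕ → ℕ} → D 0 ≡ 0 → (∀ k → f k + D (suc k) ≤ D k + g k) →
                     ∀ K → sumBelow K f + D K ≤ sumBelow K g
sumBelow-potential D0≡0 step zero = ≤-reflexive D0≡0
sumBelow-potential {f} {g} {D} D0≡0 step (suc K) = begin
  (sumBelow K f + f K) + D (suc K)  ≡⟨ +-assoc (sumBelow K f) (f K) (D (suc K)) ⟩
  sumBelow K f + (f K + D (suc K))  ≤⟨ +-mono-≤ (≤-refl {sumBelow K f}) (step K) ⟩
  sumBelow K f + (D K + g K)        ≡⟨ sym (+-assoc (sumBelow K f) (D K) (g K)) ⟩
  (sumBelow K f + D K) + g K        ≤⟨ +-mono-≤ (sumBelow-potential D0≡0 step K) ≤-refl ⟩
  sumBelow K g + g K                ∎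
  where open ≤-Reasoning

TransitiveOn : {A : Set} → (A → Set) → (A → A → Set) → Set
TransitiveOn P R = ∀ u v w → u ≢ v × v ≢ w × u ≢ w → P u → P v → P w → R u v → R v w → R u w

AsymmetricOn : {A : Set} → (A → Set) → (A → A → Set) → Set
AsymmetricOn P R = ∀ {u v} → u ≢ v → P u → P v → R u v → R v u → ⊥

lexicographic-transitive : ∀ {A : Set} {P : A → Set} {R : A → A → Set} (rank : A → ℕ) →
  (∀ {u v} → P u → P v → rank u < rank v → R u v) → AsymmetricOn P R →
  (∀ k → TransitiveOn (λ c → P c × rank c ≡ k) R) → TransitiveOn P R
lexicographic-transitive rank across asym within u v w d@(u≢v , v≢w , _) pu pv pw uv vw
  with rank u <? rank w
... | yes u<w = across pu pw u<w
... | no  u≮w = within (rank v) u v w d (pu , ru≡rv) (pv , refl) (pw , sym rv≡rw) uv vw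
  where
  ru≤rv = ≮⇒≥ (λ v<u → asym u≢v pu pv uv (across pv pu v<u))
  rv≤rw = ≮⇒≥ (λ w<v → asym v≢w pv pw vw (across pw pv w<v))
  rw≤ru = ≮⇒≥ u≮w
  ru≡rv = ≤-antisym ru≤rv (≤-trans rv≤rw rw≤ru)
  rv≡rw = ≤-antisym rv≤rw (≤-trans rw≤ru ru≤rv)

module Storyline (S : Instance) (wf : WellFormed S) where
  open Instance S
  open WellFormed wf

  special-with? : ∀ i I → Dec (SpecialWith S i I)
  special-with? i I =
    (1 ≤? i) ×-dec (i <? ℓ) ×-dec (time I ℕ.≟ i) ×-dec
    all? (λ J → (time J ℕ.≟ i) →-dec (J ≟ I)) ×-dec
    all? (λ c → T? (active c i) →-dec ¬? (T? (active c (i ∸ 1))) →-dec T? (member I c))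

  special? : ∀ i → Dec (Special S i)
  special? i = any? (special-with? i)

  char-in-prev? : ∀ i I → Dec (CharInPrev S i I)
  char-in-prev? i I = all? (λ c → T? (member I c) →-dec T? (active c (i ∸ 1)))

  only-interaction : ∀ {i I J} → SpecialWith S i I → time J ≡ i → J ≡ I
  only-interaction (_ , _ , _ , only , _) = only _

  module SpecialStep {i I} (sp : SpecialWith S i I) where
    i<ℓ : i < ℓ
    i<ℓ = proj₁ (proj₂ sp)

    i∸1<ℓ : i ∸ 1 < ℓ
    i∸1<ℓ = ≤-<-trans (m∸n≤m i 1) i<ℓ

    time≡i : time I ≡ i
    time≡i = proj₁ (proj₂ (proj₂ sp))

    char-active : ∀ {c} → Char S I c → AC S i c
    char-active {c} c∈I = subst (λ t → AC S t c) time≡i (charActive I c c∈I)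

    outsider-active-before : ∀ {c} → ¬ Char S I c → AC S i c → AC S (i ∸ 1) c
    outsider-active-before {c} c∉I ac with T? (active c (i ∸ 1))
    ... | yes ac′ = ac′
    ... | no ¬ac′ = ⊥-elim (c∉I (proj₂ (proj₂ (proj₂ (proj₂ sp))) c ac ¬ac′))

    distinct-from-char : ∀ {u c} → Char S I u → ¬ Char S I c → u ≢ c
    distinct-from-char u∈I c∉I refl = c∉I u∈I

  ComplementaryAt : Orders n → ℕ → Set
  ComplementaryAt f i = ∀ u v → u ≢ v → AC S i u → AC S i v → f i u v ≡ not (f i v u)

  crossingAt : Orders n → ℕ → Fin n → Fin n → ℕ
  crossingAt f i u v =
    count (u before v ∧ active u i ∧ active v i ∧ active u (suc i) ∧ active v (suc i) ∧
           (f i u v xor f (suc i) u v))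

  crossingsAt : Orders n → ℕ → ℕ
  crossingsAt f i = sumPairs (crossingAt f i)

  objectiveAt : (ℕ → Fin n → Fin n → Bool) → ℕ → ℕ
  objectiveAt y i = sumPairs λ u v →
    count (not (does (u ≟ v)) ∧ active u i ∧ active v i ∧ active u (suc i) ∧ active v (suc i) ∧
           y i u v)

  objectiveAt-canonical : ∀ {f i} → ComplementaryAt f i → ComplementaryAt f (suc i) →
    objectiveAt (λ i u v → f i u v ∧ not (f (suc i) u v)) i ≡ crossingsAt f i
  objectiveAt-canonical {f} {i} complementary complementary′ =
    trans (sumPairs-unordered changes no-self-changes) (sumPairs-cong pair)
    where
    changes : Fin n → Fin n → ℕ
    changes u v = count (not (does (u ≟ v)) ∧ active u i ∧ active v i ∧ active u (suc i) ∧
                         active v (suc i) ∧ (f i u v ∧ not (f (suc i) u v)))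
    no-self-changes : ∀ u → changes u u ≡ 0
    no-self-changes u rewrite dec-true (u ≟ u) refl = refl
    pair : ∀ u v → (if u before v then changes u v + changes v u else 0) ≡
                   count (u before v ∧ active u i ∧ active v i ∧ active u (suc i) ∧
                          active v (suc i) ∧ (f i u v xor f (suc i) u v))
    pair u v with toℕ u ℕ.<ᵇ toℕ v in u<ᵇv
    ... | false = refl
    ... | true  = distinct-pair u v (<⇒≢ (<ᵇ⇒< (toℕ u) (toℕ v) (≡true⇒T u<ᵇv)) ∘ cong toℕ)
      where
      distinct-pair : ∀ u v → u ≢ v → changes u v + changes v u ≡
        count (active u i ∧ active v i ∧ active u (suc i) ∧ active v (suc i) ∧
               (f i u v xor f (suc i) u v))
      distinct-pair u v u≢v rewrite dec-false (u ≟ v) u≢v | dec-false (v ≟ u) (u≢v ∘ sym) =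
        count-changes-both-ways _ _ _ _ _ _ _ _
          (λ au av → complementary v u (u≢v ∘ sym) av au)
          (λ au′ av′ → complementary′ v u (u≢v ∘ sym) av′ au′)

  module WithRepresentatives (rep : ℕ → Fin n)
                             (rep∈I : ∀ i I → SpecialWith S i I → T (member I (rep i))) where

    module FeasibleSolution (a : Assignment n) (feasible : Feasible S rep a) where
      open Feasible feasible

      x : Orders n
      x = Assignment.x a

      x-complementary : ∀ {i} → i < ℓ → ComplementaryAt x i
      x-complementary i<ℓ u v u≢v au av = ⟦⟧-complement (eq _ u v i<ℓ u≢v au av)

      x-asymmetric : ∀ {i} → i < ℓ → AsymmetricOn (AC S i) (λ u v → T (x i u v))
      x-asymmetric i<ℓ {u} {v} u≢v au av = complement-¬T (x-complementary i<ℓ v u (u≢v ∘ sym) av au)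

      lop⇒transitive : ∀ {i} {P : Fin n → Set} → i < ℓ → (∀ {c} → P c → AC S i c) →
        (∀ u v w → Distinct3 S u v w → P u → P v → P w → LOP S rep a i u v w) →
        TransitiveOn P (λ u v → T (x i u v))
      lop⇒transitive i<ℓ P⇒AC lop u v w d@(_ , _ , u≢w) pu pv pw uv vw =
        complement-T (x-complementary i<ℓ u w u≢w (P⇒AC pu) (P⇒AC pw))
                     (lop⇒not-all (lop u v w d pu pv pw) uv vw)

      module AtSpecialStep {i I} (sp : SpecialWith S i I)
        (transitive-before : TransitiveOn (AC S (i ∸ 1)) (λ u v → T (x (i ∸ 1) u v))) where
        open SpecialStep sp

        w : Fin n
        w = rep i

        w∈I : Char S I w
        w∈I = rep∈I i I sp

        tree-at : ∀ {p q c} → Char S I p → Char S I q → ¬ Char S I c → AC S i c →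
                  x i p c ≡ x i q c
        tree-at {p} {q} {c} p∈I q∈I c∉I ac with p ≟ q
        ... | yes refl = refl
        ... | no  p≢q  = subst (λ t → x t p c ≡ x t q c) time≡i
          (⟦⟧-injective (tree I p q c p≢q p∈I q∈I (subst (λ t → AC S t c) (sym time≡i) ac) c∉I))

        tree-at′ : ∀ {p q c} → Char S I p → Char S I q → ¬ Char S I c → AC S i c →
                   x i c p ≡ x i c q
        tree-at′ {p} {q} {c} p∈I q∈I c∉I ac = begin
          x i c p        ≡⟨ x-complementary i<ℓ c p (distinct-from-char p∈I c∉I ∘ sym) ac
                                                (char-active p∈I) ⟩
          not (x i p c)  ≡⟨ cong not (tree-at p∈I q∈I c∉I ac) ⟩
          not (x i q c)  ≡⟨ sym (x-complementary i<ℓ c q (distinct-from-char q∈I c∉I ∘ sym) ac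
                                                     (char-active q∈I)) ⟩
          x i c q        ∎
          where open ≡-Reasoning

        data Position (c : Fin n) : ℕ → Set where
          before : ¬ Char S I c → x i c w ≡ true  → Position c 0
          inside : Char S I c → Position c 1
          after  : ¬ Char S I c → x i c w ≡ false → Position c 2

        position : ∀ c → ∃ (Position c)
        position c with T? (member I c) | x i c w in cw
        ... | yes c∈I | _     = 1 , inside c∈I
        ... | no  c∉I | true  = 0 , before c∉I cw
        ... | no  c∉I | false = 2 , after c∉I cw

        rank : Fin n → ℕ
        rank c = proj₁ (position c)

        w-before : ∀ {c} → ¬ Char S I c → AC S i c → x i c w ≡ false → T (x i w c)
        w-before c∉I ac cw =
          complement-T (x-complementary i<ℓ w _ (distinct-from-char w∈I c∉I) (char-active w∈I) ac)
                       (subst T cw)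

        before-after : ∀ {u v} → ¬ Char S I u → ¬ Char S I v → AC S i u → AC S i v →
                       x i u w ≡ true → x i v w ≡ false → T (x i u v)
        before-after {u} {v} u∉I v∉I au av uw vw =
          complement-T (x-complementary i<ℓ u v u≢v au av)
            (λ vu → lop⇒not-all (lopRep i I sp v u (u≢v ∘ sym) av au v∉I u∉I) vu (≡true⇒T uw)
                                (w-before v∉I av vw))
          where
          u≢v : u ≢ v
          u≢v refl with trans (sym uw) vw
          ... | ()

        across : ∀ {u v k k′} → Position u k → Position v k′ → k < k′ → AC S i u → AC S i v →
                 T (x i u v)
        across _                (before _ _)      ()
        across (before u∉I uw)  (inside v∈I)      _                 au _  =
          ≡true⇒T (trans (tree-at′ v∈I w∈I u∉I au) uw)
        across (inside _)       (inside _)        (s≤s ())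
        across (after _ _)      (inside _)        (s≤s ())
        across (before u∉I uw)  (after v∉I vw)    _                 au av =
          before-after u∉I v∉I au av uw vw
        across (inside u∈I)     (after v∉I vw)    _                 _  av =
          subst T (sym (tree-at u∈I w∈I v∉I av)) (w-before v∉I av vw)
        across (after _ _)      (after _ _)       (s≤s (s≤s ()))

        kept-outside : ∀ {p q} → ¬ Char S I p → ¬ Char S I q → AC S i p → AC S i q → p ≢ q →
                       x i p w ≡ x i q w → x i p q ≡ x (i ∸ 1) p q
        kept-outside {p} {q} p∉I q∉I ap aq p≢q same-side =
          T-ext (λ pq → complement-T (x-complementary i∸1<ℓ p q p≢q ap′ aq′)
                          (λ qp → x-asymmetric i<ℓ p≢q ap aq pq
                                    (forward q∉I p∉I aq ap (p≢q ∘ sym) (sym same-side) qp)))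
                (forward p∉I q∉I ap aq p≢q same-side)
          where
          ap′ = outsider-active-before p∉I ap
          aq′ = outsider-active-before q∉I aq
          forward : ∀ {p q} → ¬ Char S I p → ¬ Char S I q → AC S i p → AC S i q → p ≢ q →
                    x i p w ≡ x i q w → T (x (i ∸ 1) p q) → T (x i p q)
          forward {p} {q} p∉I q∉I ap aq p≢q same-side prev with x i p w in pw
          ... | true  = prop⇒implication (propR1 i I sp p q p≢q ap aq p∉I q∉I) prev
                          (≡true⇒T pw) (≡true⇒T (sym same-side))
          ... | false = prop⇒implication (propR2 i I sp p q p≢q ap aq p∉I q∉I) prev
                          (w-before p∉I ap pw) (w-before q∉I aq (sym same-side))

        outside-transitive : ∀ s → TransitiveOn (λ c → ¬ Char S I c × AC S i c × x i c w ≡ s)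
                                                (λ u v → T (x i u v))
        outside-transitive s u v z d@(u≢v , v≢z , u≢z)
                           (u∉I , au , us) (v∉I , av , vs) (z∉I , az , zs) uv vz =
          subst T (sym (kept-outside u∉I z∉I au az u≢z (trans us (sym zs))))
            (transitive-before u v z d
              (outsider-active-before u∉I au) (outsider-active-before v∉I av)
              (outsider-active-before z∉I az)
              (subst T (kept-outside u∉I v∉I au av u≢v (trans us (sym vs))) uv)
              (subst T (kept-outside v∉I z∉I av az v≢z (trans vs (sym zs))) vz))

        inside-transitive : TransitiveOn (Char S I) (λ u v → T (x i u v))
        inside-transitive with char-in-prev? i I
        ... | no  ¬cip = lop⇒transitive i<ℓ char-active (lopIn i I sp ¬cip)
        ... | yes cip  = λ u v z d@(u≢v , v≢z , u≢z) u∈I v∈I z∈I uv vz →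
          subst T (sym (kept u∈I z∈I u≢z))
            (transitive-before u v z d (cip u u∈I) (cip v v∈I) (cip z z∈I)
              (subst T (kept u∈I v∈I u≢v) uv) (subst T (kept v∈I z∈I v≢z) vz))
          where
          kept : ∀ {p q} → Char S I p → Char S I q → p ≢ q → x i p q ≡ x (i ∸ 1) p q
          kept p∈I q∈I p≢q = ⟦⟧-injective (propI i I sp cip _ _ p≢q p∈I q∈I)

        same-rank-transitive : ∀ k → TransitiveOn (λ c → AC S i c × rank c ≡ k) (λ u v → T (x i u v))
        same-rank-transitive k u v z d (au , ru) (av , rv) (az , rz) =
          within-block (at u ru) (at v rv) (at z rz)
          where
          at : ∀ c → rank c ≡ k → Position c k
          at c rc = subst (Position c) rc (proj₂ (position c))
          within-block : Position u k → Position v k → Position z k →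
                         T (x i u v) → T (x i v z) → T (x i u z)
          within-block (before u∉I uw) (before v∉I vw) (before z∉I zw) =
            outside-transitive true u v z d (u∉I , au , uw) (v∉I , av , vw) (z∉I , az , zw)
          within-block (inside u∈I) (inside v∈I) (inside z∈I) =
            inside-transitive u v z d u∈I v∈I z∈I
          within-block (after u∉I uw) (after v∉I vw) (after z∉I zw) =
            outside-transitive false u v z d (u∉I , au , uw) (v∉I , av , vw) (z∉I , az , zw)

        transitive : TransitiveOn (AC S i) (λ u v → T (x i u v))
        transitive = lexicographic-transitive rank
          (λ {u} {v} au av r → across (proj₂ (position u)) (proj₂ (position v)) r au av)
          (x-asymmetric i<ℓ) same-rank-transitive

      x-transitive : ∀ i → i < ℓ → TransitiveOn (AC S i) (λ u v → T (x i u v))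
      x-transitive i i<ℓ with special? i
      ... | no ¬special = lop⇒transitive i<ℓ id (lopAll i i<ℓ ¬special)
      x-transitive zero    _   | yes (_ , () , _)
      x-transitive (suc j) j<ℓ | yes (_ , sp) =
        AtSpecialStep.transitive sp (x-transitive j (<-trans (n<1+n j) j<ℓ))

      is-solution : IsStorylineSolution S x
      is-solution = record
        { total = λ i u v i<ℓ → x-complementary i<ℓ u v
        ; trans = λ i u v w i<ℓ → x-transitive i i<ℓ u v w
        ; block = λ I u v c u≢v u∈I v∈I ac c∉I (uc , cv) →
            x-asymmetric (time<ℓ I) (λ { refl → c∉I v∈I }) ac (charActive I v v∈I) cv
              (subst T (⟦⟧-injective (tree I u v c u≢v u∈I v∈I ac c∉I)) uc)
        }

      crossings≤objective : crossings S x ≤ objective S a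
      crossings≤objective = sumBelow-mono (ℓ ∸ 1) crossingsAt≤objectiveAt
        where
        open ≤-Reasoning
        crossingsAt≤objectiveAt : ∀ i → i < ℓ ∸ 1 → crossingsAt x i ≤ objectiveAt (Assignment.y a) i
        crossingsAt≤objectiveAt i i<ℓ-1 = begin
          crossingsAt x i
            ≡⟨ sym (objectiveAt-canonical {x} (x-complementary (<-trans (n<1+n i) 1+i<ℓ))
                                              (x-complementary 1+i<ℓ)) ⟩
          objectiveAt (λ i u v → x i u v ∧ not (x (suc i) u v)) i
            ≤⟨ sumPairs-mono (λ u v →
                 guarded-count-mono (not (does (u ≟ v))) (active u i) (active v i)
                                    (active u (suc i)) (active v (suc i)) λ u≠v au av au′ av′ →
                   cr⇒implication {a = x i u v} {x (suc i) u v}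
                                  (cr i u v 1+i<ℓ (≢-from-not-does u≠v) au av au′ av′)) ⟩
          objectiveAt (Assignment.y a) i
            ∎
          where
          1+i<ℓ : suc i < ℓ
          1+i<ℓ = <∸1⇒suc< i<ℓ-1

    module Normalisation (ord : Orders n) (solution : IsStorylineSolution S ord) where
      open IsStorylineSolution solution
        renaming (total to ord-total; trans to ord-trans; block to ord-block)

      ord-acyclic : ∀ {i u v w} → i < ℓ → Distinct3 S u v w → AC S i u → AC S i v → AC S i w →
                    T (ord i u v) → T (ord i v w) → T (ord i w u) → ⊥
      ord-acyclic {i} {u} {v} {w} i<ℓ d@(_ , _ , u≢w) au av aw uv vw =
        complement-¬T (ord-total i w u i<ℓ (u≢w ∘ sym) aw au) (ord-trans i u v w i<ℓ d au av aw uv vw)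

      ord-tree : ∀ I {u v c} → Char S I u → Char S I v → AC S (time I) c → ¬ Char S I c →
                 ord (time I) u c ≡ ord (time I) v c
      ord-tree I {c = c} u∈I v∈I ac c∉I = T-ext (along u∈I v∈I) (along v∈I u∈I)
        where
        along : ∀ {p q} → Char S I p → Char S I q → T (ord (time I) p c) → T (ord (time I) q c)
        along {p} {q} p∈I q∈I pc with p ≟ q | T? (ord (time I) q c)
        ... | yes refl | _      = pc
        ... | no  _    | yes qc = qc
        ... | no  p≢q  | no ¬qc = ⊥-elim (ord-block I p q c p≢q p∈I q∈I ac c∉I
            (pc , complement-T (ord-total (time I) c q (time<ℓ I) (λ { refl → c∉I q∈I }) ac
                                          (charActive I q q∈I)) ¬qc))

      -- the pairs whose previous order (PROP-I), resp. (PROP-R1) and (PROP-R2), prescribe at step i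
      HeldBy : ℕ → Fin m → Fin n → Fin n → Set
      HeldBy i I u v = AC S (i ∸ 1) u × AC S (i ∸ 1) v ×
        (Char S I u × Char S I v × CharInPrev S i I ⊎
         ¬ Char S I u × ¬ Char S I v × ord i u (rep i) ≡ ord i v (rep i))

      Held : ℕ → Fin n → Fin n → Set
      Held i u v = ∃[ I ] SpecialWith S i I × HeldBy i I u v

      held? : ∀ i u v → Dec (Held i u v)
      held? i u v = any? λ I →
        special-with? i I ×-dec T? (active u (i ∸ 1)) ×-dec T? (active v (i ∸ 1)) ×-dec
        (T? (member I u) ×-dec T? (member I v) ×-dec char-in-prev? i I ⊎-dec
         ¬? (T? (member I u)) ×-dec ¬? (T? (member I v)) ×-dec (ord i u (rep i) Bool.≟ ord i v (rep i)))

      ord′ : Orders n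
      ord′ zero    = ord zero
      ord′ (suc i) = λ u v → if does (held? (suc i) u v) then ord′ i u v else ord (suc i) u v

      held-sym : ∀ {i u v} → Held i u v → Held i v u
      held-sym (I , sp , au , av , inj₁ (u∈I , v∈I , cip))  = I , sp , av , au , inj₁ (v∈I , u∈I , cip)
      held-sym (I , sp , au , av , inj₂ (u∉I , v∉I , same)) = I , sp , av , au , inj₂ (v∉I , u∉I , sym same)

      held-active : ∀ {i u v} → Held i u v → AC S (i ∸ 1) u × AC S (i ∸ 1) v
      held-active (_ , _ , au , av , _) = au , av

      held-by : ∀ {i I u v} → time I ≡ i → Held i u v → HeldBy i I u v
      held-by time≡i (J , spJ , held) with only-interaction spJ time≡i
      ... | refl = held

      ord′-held : ∀ {i u v} → Held i u v → ord′ i u v ≡ ord′ (i ∸ 1) u v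
      ord′-held {zero}  (_ , (() , _) , _)
      ord′-held {suc i} {u} {v} held rewrite dec-true (held? (suc i) u v) held = refl

      ord′-unheld : ∀ {i u v} → ¬ Held i u v → ord′ i u v ≡ ord i u v
      ord′-unheld {zero}          _     = refl
      ord′-unheld {suc i} {u} {v} ¬held rewrite dec-false (held? (suc i) u v) ¬held = refl

      ord′-complementary : ∀ i → i < ℓ → ComplementaryAt ord′ i
      ord′-complementary zero    0<ℓ u v = ord-total zero u v 0<ℓ
      ord′-complementary (suc i) i<ℓ u v u≢v au av = by-cases (held? (suc i) u v)
        where
        open ≡-Reasoning
        by-cases : Dec (Held (suc i) u v) → ord′ (suc i) u v ≡ not (ord′ (suc i) v u)
        by-cases (yes held) = begin
          ord′ (suc i) u v       ≡⟨ ord′-held held ⟩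
          ord′ i u v             ≡⟨ ord′-complementary i (<-trans (n<1+n i) i<ℓ) u v u≢v
                                      (proj₁ (held-active held)) (proj₂ (held-active held)) ⟩
          not (ord′ i v u)       ≡⟨ cong not (sym (ord′-held (held-sym held))) ⟩
          not (ord′ (suc i) v u) ∎
        by-cases (no ¬held) = begin
          ord′ (suc i) u v       ≡⟨ ord′-unheld ¬held ⟩
          ord (suc i) u v        ≡⟨ ord-total (suc i) u v i<ℓ u≢v au av ⟩
          not (ord (suc i) v u)  ≡⟨ cong not (sym (ord′-unheld (¬held ∘ held-sym))) ⟩
          not (ord′ (suc i) v u) ∎

      mixed-unheld : ∀ {i I u v} → time I ≡ i → Char S I u → ¬ Char S I v → ¬ Held i u v
      mixed-unheld time≡i u∈I v∉I held with held-by time≡i held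
      ... | _ , _ , inj₁ (_ , v∈I , _) = v∉I v∈I
      ... | _ , _ , inj₂ (u∉I , _ , _) = u∉I u∈I

      ord′-mixed : ∀ {i I u v} → time I ≡ i → Char S I u → ¬ Char S I v → ord′ i u v ≡ ord i u v
      ord′-mixed time≡i u∈I v∉I = ord′-unheld (mixed-unheld time≡i u∈I v∉I)

      ord′-mixed′ : ∀ {i I u v} → time I ≡ i → Char S I u → ¬ Char S I v → ord′ i v u ≡ ord i v u
      ord′-mixed′ time≡i u∈I v∉I = ord′-unheld (mixed-unheld time≡i u∈I v∉I ∘ held-sym)

      inside-unheld : ∀ {i I u v} → time I ≡ i → ¬ CharInPrev S i I → Char S I u → ¬ Held i u v
      inside-unheld time≡i ¬cip u∈I held with held-by time≡i held
      ... | _ , _ , inj₁ (_ , _ , cip) = ¬cip cip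
      ... | _ , _ , inj₂ (u∉I , _ , _) = u∉I u∈I

      canonical : Assignment n
      canonical = record { x = ord′ ; y = λ i u v → ord′ i u v ∧ not (ord′ (suc i) u v) }

      unheld-lop : ∀ {i u v w} → ¬ Held i u v → ¬ Held i v w → ¬ Held i w u →
        i < ℓ → Distinct3 S u v w → AC S i u → AC S i v → AC S i w → LOP S rep canonical i u v w
      unheld-lop {i} {u} {v} {w} ¬uv ¬vw ¬wu i<ℓ d au av aw
        rewrite ord′-unheld ¬uv | ord′-unheld ¬vw | ord′-unheld ¬wu =
        not-all⇒lop (ord i u v) (ord i v w) (ord i w u) (ord-acyclic i<ℓ d au av aw)

      nonspecial-unheld : ∀ {i u v} → ¬ Special S i → ¬ Held i u v
      nonspecial-unheld ¬special (I , sp , _) = ¬special (I , sp)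

      module OutsidePair {i I} (sp : SpecialWith S i I) {u v} (u∉I : ¬ Char S I u) (v∉I : ¬ Char S I v)
                         (au : AC S i u) (av : AC S i v) where
        open SpecialStep sp

        w : Fin n
        w = rep i

        w∈I : Char S I w
        w∈I = rep∈I i I sp

        same-side-held : ord i u w ≡ ord i v w → Held i u v
        same-side-held same = I , sp , outsider-active-before u∉I au , outsider-active-before v∉I av ,
                              inj₂ (u∉I , v∉I , same)

        after-w : ∀ {c} → ¬ Char S I c → AC S i c → T (ord i w c) → ord i c w ≡ false
        after-w c∉I ac = complement-≡false
          (ord-total i _ w i<ℓ (distinct-from-char w∈I c∉I ∘ sym) ac (char-active w∈I))

        lop-rep : u ≢ v → LOP S rep canonical i u v w
        lop-rep u≢v = not-all⇒lop (ord′ i u v) (ord′ i v w) (ord′ i w u) λ uv vw wu →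
          cycle (held? i u v) uv (subst T (ord′-mixed′ time≡i w∈I v∉I) vw)
                                 (subst T (ord′-mixed time≡i w∈I u∉I) wu)
          where
          aw = char-active w∈I
          cycle : Dec (Held i u v) → T (ord′ i u v) → T (ord i v w) → T (ord i w u) → ⊥
          cycle (yes held) _ vw wu with held-by time≡i held
          ... | _ , _ , inj₁ (u∈I , _)      = u∉I u∈I
          ... | _ , _ , inj₂ (_ , _ , same) =
            complement-¬T (ord-total i u w i<ℓ (distinct-from-char w∈I u∉I ∘ sym) au aw) wu
                          (subst T (sym same) vw)
          cycle (no ¬held) uv vw wu =
            ord-acyclic i<ℓ (u≢v , distinct-from-char w∈I v∉I ∘ sym , distinct-from-char w∈I u∉I ∘ sym)
                        au av aw (subst T (ord′-unheld ¬held) uv) vw wu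

        prop-r1 : ⟦ ord′ i u v ⟧ ℤ.≥ ⟦ ord′ (i ∸ 1) u v ⟧ ℤ.+ ⟦ ord′ i u w ⟧ ℤ.+ ⟦ ord′ i v w ⟧ ℤ.- ℤ.+ 2
        prop-r1 = implication⇒prop _ _ _ _ λ kept uw vw →
          subst T (sym (ord′-held (same-side-held
            (trans (T⇒≡true (subst T (ord′-mixed′ time≡i w∈I u∉I) uw))
                   (sym (T⇒≡true (subst T (ord′-mixed′ time≡i w∈I v∉I) vw))))))) kept

        prop-r2 : ⟦ ord′ i u v ⟧ ℤ.≥ ⟦ ord′ (i ∸ 1) u v ⟧ ℤ.+ ⟦ ord′ i w u ⟧ ℤ.+ ⟦ ord′ i w v ⟧ ℤ.- ℤ.+ 2
        prop-r2 = implication⇒prop _ _ _ _ λ kept wu wv →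
          subst T (sym (ord′-held (same-side-held
            (trans (after-w u∉I au (subst T (ord′-mixed time≡i w∈I u∉I) wu))
                   (sym (after-w v∉I av (subst T (ord′-mixed time≡i w∈I v∉I) wv))))))) kept

      canonical-feasible : Feasible S rep canonical
      canonical-feasible = record
        { eq     = λ i u v i<ℓ u≢v au av →
            complement-⟦⟧ _ _ (ord′-complementary i i<ℓ u v u≢v au av)
        ; tree   = λ I u v c _ u∈I v∈I ac c∉I → cong ⟦_⟧ (begin
            ord′ (time I) u c  ≡⟨ ord′-mixed refl u∈I c∉I ⟩
            ord (time I) u c   ≡⟨ ord-tree I u∈I v∈I ac c∉I ⟩
            ord (time I) v c   ≡⟨ sym (ord′-mixed refl v∈I c∉I) ⟩
            ord′ (time I) v c  ∎)
        ; cr     = λ i u v _ _ _ _ _ _ → cr-tight (ord′ i u v) (ord′ (suc i) u v)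
        ; lopAll = λ i i<ℓ ¬special u v w → unheld-lop (nonspecial-unheld ¬special)
                     (nonspecial-unheld ¬special) (nonspecial-unheld ¬special) i<ℓ
        ; lopRep = λ i I sp u v u≢v au av u∉I v∉I → OutsidePair.lop-rep sp u∉I v∉I au av u≢v
        ; propR1 = λ i I sp u v _ au av u∉I v∉I → OutsidePair.prop-r1 sp u∉I v∉I au av
        ; propR2 = λ i I sp u v _ au av u∉I v∉I → OutsidePair.prop-r2 sp u∉I v∉I au av
        ; propI  = λ i I sp cip u v _ u∈I v∈I →
            cong ⟦_⟧ (ord′-held (I , sp , cip u u∈I , cip v v∈I , inj₁ (u∈I , v∈I , cip)))
        ; lopIn  = λ i I sp ¬cip u v w d u∈I v∈I w∈I → let open SpecialStep sp in
            unheld-lop (inside-unheld time≡i ¬cip u∈I) (inside-unheld time≡i ¬cip v∈I)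
                       (inside-unheld time≡i ¬cip w∈I) i<ℓ d
                       (char-active u∈I) (char-active v∈I) (char-active w∈I)
        }
        where open ≡-Reasoning

      canonical-objective : objective S canonical ≡ crossings S ord′
      canonical-objective = sumBelow-cong (ℓ ∸ 1) λ i i<ℓ-1 →
        objectiveAt-canonical {ord′} (ord′-complementary i (<-trans (n<1+n i) (<∸1⇒suc< i<ℓ-1)))
                              (ord′-complementary (suc i) (<∸1⇒suc< i<ℓ-1))

      disagreement : ℕ → Fin n → Fin n → ℕ
      disagreement i u v = count (u before v ∧ active u i ∧ active v i ∧ (ord′ i u v xor ord i u v))

      disagreementAt : ℕ → ℕ
      disagreementAt i = sumPairs (disagreement i)

      initial-agreement : disagreementAt 0 ≡ 0
      initial-agreement = trans (sumPairs-cong agree) (sumPairs-zero {n})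
        where
        agree : ∀ u v → count (u before v ∧ active u 0 ∧ active v 0 ∧ (ord 0 u v xor ord 0 u v)) ≡ 0
        agree u v rewrite xor-same (ord 0 u v) | ∧-zeroʳ (active v 0) | ∧-zeroʳ (active u 0)
                        | ∧-zeroʳ (u before v) = refl

      crossing-step : ∀ k → crossingsAt ord′ k + disagreementAt (suc k) ≤
                            disagreementAt k + crossingsAt ord k
      crossing-step k =
        subst₂ _≤_ (sumPairs-+ (crossingAt ord′ k) (disagreement (suc k)))
                   (sumPairs-+ (disagreement k) (crossingAt ord k)) (sumPairs-mono λ u v →
          hold-step (u before v) (active u k) (active v k) (active u (suc k)) (active v (suc k))
                    (ord′ k u v) (ord k u v) (ord (suc k) u v) (does (held? (suc k) u v))
                    (held-active ∘ T-does⇒ (held? (suc k) u v)))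

      crossings-decrease : crossings S ord′ ≤ crossings S ord
      crossings-decrease =
        ≤-trans (m≤m+n _ _) (sumBelow-potential initial-agreement crossing-step (ℓ ∸ 1))

theorem11 : (S : Instance) → WellFormed S →
            (rep : ℕ → Fin (Instance.n S)) →
            (∀ i I → SpecialWith S i I → T (Instance.member S I (rep i))) →
            (a : Assignment (Instance.n S)) → Optimal S rep a →
            IsStorylineSolution S (Assignment.x a) ×
            (∀ ord → IsStorylineSolution S ord →
               crossings S (Assignment.x a) ≤ crossings S ord)
theorem11 S wf rep rep∈I a (feasible , optimal) = is-solution , λ ord solution →
  let open Normalisation ord solution in begin
    crossings S x          ≤⟨ crossings≤objective ⟩
    objective S a          ≤⟨ optimal canonical canonical-feasible ⟩
    objective S canonical  ≡⟨ canonical-objective ⟩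
    crossings S ord′       ≤⟨ crossings-decrease ⟩
    crossings S ord        ∎
  where
  open Storyline S wf
  open WithRepresentatives rep rep∈I
  open FeasibleSolution a feasible
  open ≤-Reasoning
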